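{- For any $n\geq1$, the set $\mathcal{A}^1(Z_n)$ equals $\{\,\varepsilon f : f\in\mathcal{A}(\varepsilon Z_n)\,\}$, where $(\varepsilon f)(i)=f(\varepsilon(i))$.
   Context: $\mathcal{A}^1(Z_n)$ (relaxed $Z_n$-partitions) is the set of maps $g:[n]\to\{1,2,\dots\}$ with $g(j)\leq g(j+1)$ for odd $j\in[n-1]$ and $g(j)\geq g(j+1)$ for even $j\in[n-1]$. The zig-zag poset $Z_n$ on $[n]$ is generated by $j<j+1$ for odd $j$ and $j>j+1$ for even $j$; $\varepsilon\in S_n$ is the involution swapping $2i$ and $2i+1$ for each $i\geq1$ with $2i+1\leq n$; $\varepsilon Z_n$ is the poset with $\varepsilon(i)<\varepsilon(j)$ iff $i<_{Z_n}j$. For a poset $P$ on $[n]$, $\mathcal{A}(P)$ is the set of $P$-partitions: maps $f:[n]\to\{1,2,\dots\}$ such that for $i<_Pj$, $f(i)\leq f(j)$ if $i<j$ and $f(i)<f(j)$ if $i>j$. -}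

module Defs where

open import Data.Nat using (ℕ; zero; suc; _≤_; _<_; _≥_; _%_)
open import Data.Fin using (Fin; zero; suc; toℕ)
import Data.Fin as F
open import Data.Product using (_×_; Σ-syntax)
open import Data.Sum using (_⊎_)
open import Relation.Binary.PropositionalEquality using (_≡_)
open import Relation.Binary.Construct.Closure.Transitive using (TransClosure)

-- Elements of [n] = {1,…,n} are represented by Fin n; k : Fin n stands for
-- the number lab k = toℕ k + 1.
lab : ∀ {n} → Fin n → ℕ
lab k = suc (toℕ k)

Odd Even : ℕ → Set
Odd m = m % 2 ≡ 1
Even m = m % 2 ≡ 0

ZGen : ∀ {n} → Fin n → Fin n → Set
ZGen i j = (lab j ≡ suc (lab i) × Odd (lab i))
         ⊎ (lab i ≡ suc (lab j) × Even (lab j))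

ZLt : ∀ {n} → Fin n → Fin n → Set
ZLt {n} = TransClosure (ZGen {n})

swapPairs : ∀ {m} → Fin m → Fin m
swapPairs {suc zero} zero = zero
swapPairs {suc (suc m)} zero = suc zero
swapPairs {suc (suc m)} (suc zero) = zero
swapPairs {suc (suc m)} (suc (suc k)) = suc (suc (swapPairs k))

-- ε : [n] → [n] fixes 1 and swaps 2i ↔ 2i+1 whenever 2i+1 ≤ n
-- (in labels: 1 ↦ 1, 2 ↔ 3, 4 ↔ 5, …, and n fixed if n is even).
ε : ∀ {n} → Fin n → Fin n
ε zero = zero
ε (suc k) = suc (swapPairs k)

εZLt : ∀ {n} → Fin n → Fin n → Set
εZLt {n} a b = Σ[ i ∈ Fin n ] Σ[ j ∈ Fin n ] (ε i ≡ a × ε j ≡ b × ZLt i j)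

Positive : ∀ {n} → (Fin n → ℕ) → Set
Positive {n} f = (i : Fin n) → 1 ≤ f i

IsPPartition : ∀ {n} → (Fin n → Fin n → Set) → (Fin n → ℕ) → Set
IsPPartition {n} P f = Positive f ×
  ((i j : Fin n) → P i j →
     (lab i < lab j → f i ≤ f j) × (lab j < lab i → f i < f j))

IsRelaxedZPartition : (n : ℕ) → (Fin n → ℕ) → Set
IsRelaxedZPartition n g = Positive g ×
  ((i j : Fin n) → lab j ≡ suc (lab i) →
     (Odd (lab i) → g i ≤ g j) × (Even (lab i) → g i ≥ g j))

-- Relabelling Z_n by the involution ε makes it naturally labelled: whenever
-- i <_{Z_n} j we have ε(i) < ε(j) as integers.  For a naturally labelled poset
-- the strict inequalities in the definition of a P-partition never apply, so
-- 𝒜(εZ_n) consists of the positive order-preserving maps of εZ_n.  Composing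
-- with ε identifies these with the positive order-preserving maps of Z_n, and
-- those are exactly the relaxed Z_n-partitions, since being order-preserving
-- only has to be checked on the covering relations between j and j+1.
module Submission where

open import Defs
open import Data.Nat using (ℕ; zero; suc; _*_; _+_; _/_; _≤_; _<_; z≤n; s≤s)
open import Data.Nat.Properties
  using (suc-injective; ≤-trans; ≤-reflexive; <-trans; <-asym; n≤1+n; n<1+n; module ≤-Reasoning)
open import Data.Nat.DivMod using (m≡m%n+[m/n]*n)
open import Data.Fin using (Fin; zero; suc; toℕ)
open import Data.Fin.Properties using (toℕ<n)
open import Data.Product using (_×_; _,_; proj₁; proj₂; Σ-syntax; ∃-syntax)
open import Data.Sum using (inj₁; inj₂)
open import Function.Base using (_∘_)
open import Function.Bundles using (_⇔_; mk⇔; Equivalence)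
open import Relation.Nullary using (contradiction)
open import Relation.Binary.Core using (Rel; _⇒_)
open import Relation.Binary.Definitions using (Transitive)
open import Relation.Binary.PropositionalEquality
  using (_≡_; refl; sym; trans; cong; subst; subst₂)
open import Relation.Binary.Construct.Closure.Transitive using (TransClosure; [_]; _∷_)

TransClosure-fold : ∀ {a ℓ₁ ℓ₂} {A : Set a} {R : Rel A ℓ₁} {S : Rel A ℓ₂} →
  Transitive S → R ⇒ S → TransClosure R ⇒ S
TransClosure-fold S-trans R⇒S [ r ]    = R⇒S r
TransClosure-fold S-trans R⇒S (r ∷ rs) = S-trans (R⇒S r) (TransClosure-fold S-trans R⇒S rs)

Odd-suc⇒even : ∀ t → Odd (suc t) → ∃[ a ] t ≡ a * 2
Odd-suc⇒even t odd =
  suc t / 2 , suc-injective (trans (m≡m%n+[m/n]*n (suc t) 2) (cong (_+ (suc t / 2) * 2) odd))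

Even-suc⇒odd : ∀ t → Even (suc t) → ∃[ a ] t ≡ suc (a * 2)
Even-suc⇒odd t even
  with suc t / 2 | trans (m≡m%n+[m/n]*n (suc t) 2) (cong (_+ (suc t / 2) * 2) even)
... | suc a | eq = a , suc-injective eq

swapPairs-involutive : ∀ {m} (k : Fin m) → swapPairs (swapPairs k) ≡ k
swapPairs-involutive {suc zero}    zero          = refl
swapPairs-involutive {suc (suc m)} zero          = refl
swapPairs-involutive {suc (suc m)} (suc zero)    = refl
swapPairs-involutive {suc (suc m)} (suc (suc k)) = cong (λ x → suc (suc x)) (swapPairs-involutive k)

ε-involutive : ∀ {n} (i : Fin n) → ε (ε i) ≡ i
ε-involutive zero    = refl
ε-involutive (suc k) = cong suc (swapPairs-involutive k)

-- Parities in lemma names refer to the 0-based index toℕ, not to the label lab = toℕ + 1.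
swapPairs-odd : ∀ {m} (k : Fin m) a → toℕ k ≡ suc (a * 2) → suc (toℕ (swapPairs k)) ≡ toℕ k
swapPairs-odd {suc (suc m)} (suc zero)    zero    _ = refl
swapPairs-odd {suc (suc m)} (suc (suc k)) (suc a) e =
  cong (λ x → suc (suc x)) (swapPairs-odd k a (suc-injective (suc-injective e)))

swapPairs-even-≥ : ∀ {m} (k : Fin m) a → toℕ k ≡ a * 2 → toℕ k ≤ toℕ (swapPairs k)
swapPairs-even-≥ {suc zero}    zero          a       _ = z≤n
swapPairs-even-≥ {suc (suc m)} zero          a       _ = z≤n
swapPairs-even-≥ {suc (suc m)} (suc (suc k)) (suc a) e =
  s≤s (s≤s (swapPairs-even-≥ k a (suc-injective (suc-injective e))))

swapPairs-even : ∀ {m} (k : Fin m) a → toℕ k ≡ a * 2 → suc (toℕ k) < m →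
  toℕ (swapPairs k) ≡ suc (toℕ k)
swapPairs-even {suc zero}    zero          a       _ (s≤s ())
swapPairs-even {suc (suc m)} zero          a       _ _                 = refl
swapPairs-even {suc (suc m)} (suc (suc k)) (suc a) e (s≤s (s≤s k+1<m)) =
  cong (λ x → suc (suc x)) (swapPairs-even k a (suc-injective (suc-injective e)) k+1<m)

ε-even-pred : ∀ {n} (i : Fin n) a → toℕ i ≡ suc a * 2 → suc (toℕ (ε i)) ≡ toℕ i
ε-even-pred (suc k) a e = cong suc (swapPairs-odd k a (suc-injective e))

ε-even-≤ : ∀ {n} (i : Fin n) a → toℕ i ≡ a * 2 → toℕ (ε i) ≤ toℕ i
ε-even-≤ zero    a       _ = z≤n
ε-even-≤ (suc k) (suc a) e = ≤-trans (n≤1+n _) (≤-reflexive (ε-even-pred (suc k) a e))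

ε-odd-≥ : ∀ {n} (i : Fin n) a → toℕ i ≡ suc (a * 2) → toℕ i ≤ toℕ (ε i)
ε-odd-≥ (suc k) a e = s≤s (swapPairs-even-≥ k a (suc-injective e))

ε-odd-suc : ∀ {n} (i : Fin n) a → toℕ i ≡ suc (a * 2) → suc (toℕ i) < n →
  toℕ (ε i) ≡ suc (toℕ i)
ε-odd-suc (suc k) a e (s≤s i+1<n) = cong suc (swapPairs-even k a (suc-injective e) i+1<n)

open ≤-Reasoning

ZGen⇒ε-< : ∀ {n} {i j : Fin n} → ZGen i j → toℕ (ε i) < toℕ (ε j)
ZGen⇒ε-< {i = i} {j} (inj₁ (j≡i+1 , odd)) with Odd-suc⇒even (toℕ i) odd
... | a , i≡2a = begin-strict
  toℕ (ε i)   ≤⟨ ε-even-≤ i a i≡2a ⟩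
  toℕ i       <⟨ n<1+n (toℕ i) ⟩
  suc (toℕ i) ≡⟨ sym j≡suc-i ⟩
  toℕ j       ≤⟨ ε-odd-≥ j a (trans j≡suc-i (cong suc i≡2a)) ⟩
  toℕ (ε j)   ∎
  where
  j≡suc-i : toℕ j ≡ suc (toℕ i)
  j≡suc-i = suc-injective j≡i+1
ZGen⇒ε-< {n} {i} {j} (inj₂ (i≡j+1 , even)) with Even-suc⇒odd (toℕ j) even
... | a , j≡2a+1 = begin-strict
  toℕ (ε i)   ≡⟨ suc-injective (trans (ε-even-pred i a (trans i≡suc-j (cong suc j≡2a+1))) i≡suc-j) ⟩
  toℕ j       <⟨ n<1+n (toℕ j) ⟩
  suc (toℕ j) ≡⟨ sym (ε-odd-suc j a j≡2a+1 (subst (_< n) i≡suc-j (toℕ<n i))) ⟩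
  toℕ (ε j)   ∎
  where
  i≡suc-j : toℕ i ≡ suc (toℕ j)
  i≡suc-j = suc-injective i≡j+1

ZLt⇒ε-< : ∀ {n} {i j : Fin n} → ZLt i j → toℕ (ε i) < toℕ (ε j)
ZLt⇒ε-< = TransClosure-fold <-trans ZGen⇒ε-<

εZLt⇒lab-< : ∀ {n} {a b : Fin n} → εZLt a b → lab a < lab b
εZLt⇒lab-< (_ , _ , refl , refl , i<j) = s≤s (ZLt⇒ε-< i<j)

εZLt⇒ZLt-ε : ∀ {n} {a b : Fin n} → εZLt a b → ZLt (ε a) (ε b)
εZLt⇒ZLt-ε (i , j , refl , refl , i<j) = subst₂ ZLt (sym (ε-involutive i)) (sym (ε-involutive j)) i<j

Monotone : ∀ {n} → (Fin n → Fin n → Set) → (Fin n → ℕ) → Set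
Monotone {n} P f = (i j : Fin n) → P i j → f i ≤ f j

PPartition⇔monotone : ∀ {n} (P : Fin n → Fin n → Set) →
  (∀ {i j} → P i j → lab i < lab j) → (f : Fin n → ℕ) →
  IsPPartition P f ⇔ (Positive f × Monotone P f)
PPartition⇔monotone P naturallyLabelled f = mk⇔
  (λ (pos , partition) → pos , λ i j i<j → proj₁ (partition i j i<j) (naturallyLabelled i<j))
  (λ (pos , mono) → pos , λ i j i<j →
    (λ _ → mono i j i<j) , (λ j<i → contradiction j<i (<-asym (naturallyLabelled i<j))))

relaxed⇔ZLt-monotone : ∀ n (g : Fin n → ℕ) → IsRelaxedZPartition n g ⇔ (Positive g × Monotone ZLt g)
relaxed⇔ZLt-monotone n g = mk⇔
  (λ relaxed → proj₁ relaxed , λ i j → TransClosure-fold {S = λ i j → g i ≤ g j} ≤-trans (ZGen⇒≤ relaxed))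
  (λ (pos , mono) → pos , λ i j j≡i+1 →
    (λ odd → mono i j [ inj₁ (j≡i+1 , odd) ]) , (λ even → mono j i [ inj₂ (j≡i+1 , even) ]))
  where
  ZGen⇒≤ : IsRelaxedZPartition n g → ∀ {i j} → ZGen i j → g i ≤ g j
  ZGen⇒≤ (_ , covers) (inj₁ (j≡i+1 , odd))  = proj₁ (covers _ _ j≡i+1) odd
  ZGen⇒≤ (_ , covers) (inj₂ (i≡j+1 , even)) = proj₂ (covers _ _ i≡j+1) even

relaxed⇒εPPartition : ∀ n (g : Fin n → ℕ) → IsRelaxedZPartition n g → IsPPartition εZLt (g ∘ ε)
relaxed⇒εPPartition n g relaxed with Equivalence.to (relaxed⇔ZLt-monotone n g) relaxed
... | pos , mono = Equivalence.from (PPartition⇔monotone εZLt εZLt⇒lab-< (g ∘ ε))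
  (pos ∘ ε , λ a b a<b → mono (ε a) (ε b) (εZLt⇒ZLt-ε a<b))

εPPartition⇒relaxed : ∀ n (f g : Fin n → ℕ) → IsPPartition εZLt f → (∀ i → g i ≡ f (ε i)) →
  IsRelaxedZPartition n g
εPPartition⇒relaxed n f g partition g≡f∘ε
  with Equivalence.to (PPartition⇔monotone εZLt εZLt⇒lab-< f) partition
... | pos , mono = Equivalence.from (relaxed⇔ZLt-monotone n g)
  ( (λ i → subst (1 ≤_) (sym (g≡f∘ε i)) (pos (ε i)))
  , (λ i j i<j → subst₂ _≤_ (sym (g≡f∘ε i)) (sym (g≡f∘ε j)) (mono (ε i) (ε j) (i , j , refl , refl , i<j))))

proposition3p10 : (n : ℕ) → 1 ≤ n → (g : Fin n → ℕ) →
    IsRelaxedZPartition n g ⇔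
    (Σ[ f ∈ (Fin n → ℕ) ] (IsPPartition (εZLt {n}) f × ((i : Fin n) → g i ≡ f (ε i))))
proposition3p10 n _ g = mk⇔
  (λ relaxed → g ∘ ε , relaxed⇒εPPartition n g relaxed , λ i → cong g (sym (ε-involutive i)))
  (λ (f , partition , g≡f∘ε) → εPPartition⇒relaxed n f g partition g≡f∘ε)
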